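{- Let $\langle \mathcal{N},\mathcal{D},\theta\rangle$ be a $d$-dimensional sandpile model. For any finite configurations $c,c'$ with $c\rightharpoonup^* c'$, and any cells $x,y\in\mathbb{Z}^d$ with $y\in x+\mathcal{N}$, $$|\mathrm{odo}_{\rightharpoonup}(c,c')(x)-\mathrm{odo}_{\rightharpoonup}(c,c')(y)|\le\sum_{z\in\mathbb{Z}^d}c(z).$$
   Context: A $d$-dimensional sandpile model is a triple $\langle \mathcal{N},\mathcal{D},\theta\rangle$ with $\mathcal{N}$ a finite subset of $\mathbb{Z}^d\setminus\{0^d\}$ whose nonnegative integer combinations give $\mathbb{Z}^d$, $\mathcal{D}:\mathcal{N}\to\mathbb{N}_+$, $\theta=\sum_{v\in\mathcal{N}}\mathcal{D}(v)$. Configurations are $c:\mathbb{Z}^d\to\mathbb{N}$, finite if they contain finitely many grains. Sequential update: $c\rightharpoonup_x c'$ means that if $c(x)\ge\theta$ then $c'(x)=c(x)-\theta$, $c'(x+v)=c(x+v)+\mathcal{D}(v)$ for each $v\in\mathcal{N}$, and $c'=c$ elsewhere (if $c(x)<\theta$ then $c'=c$); $\rightharpoonup^*$ is the reflexive transitive closure of $\bigcup_x\rightharpoonup_x$. $\mathrm{odo}_{\rightharpoonup}(c,c')(x)$ is the number of topplings of cell $x$ along the sequential sequence leading from $c$ to $c'$. -}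

module Defs where

open import Data.Nat using (ℕ; zero; suc; _+_; _∸_; _≤_; _≤?_)
open import Data.Integer as ℤ using (ℤ)
open import Data.Fin using (Fin; zero; suc)
open import Data.Vec using (Vec; zipWith; replicate)
open import Data.Vec.Properties using (≡-dec)
open import Data.List using (List; []; _∷_; length; map)
open import Data.Nat.ListAction using (sum)
open import Data.List.Relation.Unary.All using (All)
open import Data.List.Relation.Unary.Unique.Propositional using (Unique)
open import Data.List.Membership.Propositional using (_∈_)
open import Data.Product using (Σ; ∃; _×_; _,_; proj₁; proj₂)
open import Relation.Nullary using (yes; no; ¬_)
open import Relation.Binary.PropositionalEquality using (_≡_; _≢_)

Cell : ℕ → Set
Cell d = Vec ℤ d

_⊕_ : ∀ {d} → Cell d → Cell d → Cell d
_⊕_ = zipWith ℤ._+_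

0ᵈ : ∀ d → Cell d
0ᵈ d = replicate d (ℤ.+ 0)

_·_ : ∀ {d} → ℕ → Cell d → Cell d
_·_ {d} zero v = 0ᵈ d
(suc k) · v = v ⊕ (k · v)

_≟ᶜ_ : ∀ {d} (x y : Cell d) → Relation.Nullary.Dec (x ≡ y)
_≟ᶜ_ = ≡-dec ℤ._≟_

lincomb : ∀ {d} (N : List (Cell d × ℕ)) → (Fin (length N) → ℕ) → Cell d
lincomb {d} [] a = 0ᵈ d
lincomb ((v , _) ∷ N) a = (a zero · v) ⊕ lincomb N (λ i → a (suc i))

-- A d-dimensional sandpile model ⟨𝒩, 𝒟, θ⟩.  The neighbourhood 𝒩 together
-- with 𝒟 is given as a duplicate-free list of pairs (v , 𝒟(v)).
record SandpileModel (d : ℕ) : Set where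
  field
    nbhd      : List (Cell d × ℕ)
    distinct  : Unique (map proj₁ nbhd)
    nonzero   : All (λ p → proj₁ p ≢ 0ᵈ d) nbhd
    positive  : All (λ p → 1 ≤ proj₂ p) nbhd
    generates : ∀ (z : Cell d) → Σ (Fin (length nbhd) → ℕ) (λ a → z ≡ lincomb nbhd a)

  θ : ℕ
  θ = sum (map proj₂ nbhd)

  𝒩 : List (Cell d)
  𝒩 = map proj₁ nbhd

open SandpileModel public

Config : ℕ → Set
Config d = Cell d → ℕ

received : ∀ {d} → List (Cell d × ℕ) → Cell d → Cell d → ℕ
received [] x z = 0
received ((v , k) ∷ N) x z with (x ⊕ v) ≟ᶜ z
... | yes _ = k + received N x z
... | no  _ = received N x z

topple : ∀ {d} → SandpileModel d → Cell d → Config d → Config d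
topple M x c z with θ M ≤? c x
... | no _ = c z
... | yes _ with z ≟ᶜ x
...   | yes _ = c x ∸ θ M
...   | no _  = c z + received (nbhd M) x z

run : ∀ {d} → SandpileModel d → Config d → List (Cell d) → Config d
run M c [] = c
run M c (x ∷ xs) = run M (topple M x c) xs

_⊢_⇀*_via_ : ∀ {d} → SandpileModel d → Config d → Config d → List (Cell d) → Set
M ⊢ c ⇀* c' via xs = ∀ z → run M c xs z ≡ c' z

odo : ∀ {d} → SandpileModel d → Config d → List (Cell d) → Cell d → ℕ
odo M c [] y = 0
odo M c (x ∷ xs) y with θ M ≤? c x | x ≟ᶜ y
... | yes _ | yes _ = suc (odo M (topple M x c) xs y)
... | _     | _     = odo M (topple M x c) xs y

-- A finite configuration c together with a duplicate-free list L containing its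
-- support; then Σ_{z ∈ ℤ^d} c(z) = sum (map c L).
SupportList : ∀ {d} → Config d → List (Cell d) → Set
SupportList c L = Unique L × (∀ z → c z ≢ 0 → z ∈ L)

Finite : ∀ {d} → Config d → Set
Finite c = ∃ λ L → SupportList c L

totalGrains : ∀ {d} → Config d → List (Cell d) → ℕ
totalGrains c L = sum (map c L)

module Submission where

-- Let u = odo M c xs.  For a finite set P of cells, one toppling of w changes the
-- number of grains on P by entering(w) − leaving(w), the grains it moves across
-- the boundary of P.  Summed over the run (run-balance):
--     mass_P(run c xs) + Σ_w u(w)·leaving(w) = mass_P(c) + Σ_w u(w)·entering(w),
-- and since the toppling rule is translation invariant, Σ_w leaving(w) equals
-- Σ_w entering(w) (flux-balance).  Hence, if every cell of P toppled at least m
-- times and every other cell at most m times (level-cut):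
--     Σ_w (u(w) − m)·leaving(w) + Σ_w (m − u(w))·entering(w) ≤ mass_P(c).
-- For y = x + v with v ∈ 𝒩 take m = u(y) and P = {u > u(y)} if u(x) > u(y),
-- P = {u ≥ u(y)} if u(x) < u(y): the single term at x is then ≥ |u(x) − u(y)|,
-- and mass_P(c) is at most the total number of grains of c.

open import Defs
open import Data.Nat using (ℕ; zero; suc; _+_; _*_; _∸_; _≤_; _<_; z≤n; s≤s; ∣_-_∣; >-nonZero) renaming (_≟_ to _≟ℕ_)
open import Data.Nat.Properties
open import Data.Nat.ListAction using (sum)
open import Data.Integer as ℤ using ()
import Data.Integer.Properties as ℤP
open import Data.Vec as Vec using ()
open import Data.Vec.Properties using (zipWith-assoc; zipWith-identityˡ; zipWith-identityʳ; zipWith-inverseˡ; zipWith-inverseʳ)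
open import Data.List using (List; []; _∷_; map; filter; deduplicate; _++_; concatMap)
open import Data.List.Relation.Unary.All as All using (All; _∷_)
open import Data.List.Relation.Unary.All.Properties using (All¬⇒¬Any)
open import Data.List.Relation.Unary.Any as Any using (here; there)
open import Data.List.Relation.Unary.Unique.Propositional using (Unique; _∷_)
open import Data.List.Membership.Propositional using (_∈_; _∉_)
open import Data.List.Membership.Propositional.Properties
  using (∈-map⁺; ∈-map⁻; ∈-++⁺ˡ; ∈-++⁺ʳ; ∈-concatMap⁺; ∈-filter⁺; ∈-filter⁻; ∈-deduplicate⁺; ∈-deduplicate⁻)
open import Data.Product using (∃; _×_; _,_; proj₁; proj₂)
open import Data.Sum using (_⊎_; inj₁; inj₂)
open import Data.Empty using (⊥-elim)
open import Relation.Nullary using (yes; no; ¬_)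
open import Relation.Binary.Definitions using (DecidableEquality; Tri; tri<; tri≈; tri>)
open import Relation.Binary.PropositionalEquality
open import Algebra.Properties.CommutativeSemigroup +-commutativeSemigroup using (interchange; x∙yz≈xz∙y; xy∙z≈xz∙y; xy∙z≈x∙zy)
open import Algebra.Properties.CommutativeSemigroup *-commutativeSemigroup using () renaming (x∙yz≈y∙xz to *-left-comm)

private variable A B : Set

∑ : List A → (A → ℕ) → ℕ
∑ L f = sum (map f L)

∑-cong∈ : ∀ (L : List A) {f g : A → ℕ} → (∀ {z} → z ∈ L → f z ≡ g z) → ∑ L f ≡ ∑ L g
∑-cong∈ [] e = refl
∑-cong∈ (x ∷ L) e = cong₂ _+_ (e (here refl)) (∑-cong∈ L (λ z∈L → e (there z∈L)))

∑-cong : ∀ (L : List A) {f g : A → ℕ} → (∀ z → f z ≡ g z) → ∑ L f ≡ ∑ L g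
∑-cong L e = ∑-cong∈ L (λ {z} _ → e z)

∑-zero : ∀ (L : List A) → ∑ L (λ _ → 0) ≡ 0
∑-zero [] = refl
∑-zero (x ∷ L) = ∑-zero L

∑-+ : ∀ (L : List A) (f g : A → ℕ) → ∑ L (λ z → f z + g z) ≡ ∑ L f + ∑ L g
∑-+ [] f g = refl
∑-+ (x ∷ L) f g = trans (cong (f x + g x +_) (∑-+ L f g)) (interchange (f x) (g x) (∑ L f) (∑ L g))

∑-*ˡ : ∀ (L : List A) (k : ℕ) (f : A → ℕ) → ∑ L (λ z → k * f z) ≡ k * ∑ L f
∑-*ˡ [] k f = sym (*-zeroʳ k)
∑-*ˡ (x ∷ L) k f = trans (cong (k * f x +_) (∑-*ˡ L k f)) (sym (*-distribˡ-+ k (f x) (∑ L f)))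

∑-mono : ∀ (L : List A) {f g : A → ℕ} → (∀ z → f z ≤ g z) → ∑ L f ≤ ∑ L g
∑-mono [] le = z≤n
∑-mono (x ∷ L) le = +-mono-≤ (le x) (∑-mono L le)

∑-term : ∀ (L : List A) {f : A → ℕ} {x : A} → x ∈ L → f x ≤ ∑ L f
∑-term (y ∷ L) {f} (here refl) = m≤m+n (f y) (∑ L f)
∑-term (y ∷ L) {f} (there x∈L) = ≤-trans (∑-term L x∈L) (m≤n+m (∑ L f) (f y))

∑-swap : ∀ (L : List A) (K : List B) (f : A → B → ℕ) →
         ∑ L (λ a → ∑ K (f a)) ≡ ∑ K (λ b → ∑ L (λ a → f a b))
∑-swap [] K f = sym (∑-zero K)
∑-swap (x ∷ L) K f = trans (cong (∑ K (f x) +_) (∑-swap L K f)) (sym (∑-+ K (f x) _))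

split-at-level : ∀ n m k → (k ≢ 0 → m ≤ n) → (n ∸ m) * k + m * k ≡ n * k
split-at-level n m zero _ = trans (cong₂ _+_ (*-zeroʳ (n ∸ m)) (*-zeroʳ m)) (sym (*-zeroʳ n))
split-at-level n m k@(suc _) m≤n = trans (sym (*-distribʳ-+ k (n ∸ m) m)) (cong (_* k) (m∸n+n≡m (m≤n (λ ()))))

module Counting (_≟_ : DecidableEquality A) where

  open import Data.List.Membership.DecPropositional _≟_ using (_∈?_)

  δ : A → A → ℕ
  δ a b with a ≟ b
  ... | yes _ = 1
  ... | no  _ = 0

  δ-sym : ∀ a b → δ a b ≡ δ b a
  δ-sym a b with a ≟ b | b ≟ a
  ... | yes _   | yes _   = refl
  ... | no  _   | no  _   = refl
  ... | yes a≡b | no  b≢a = ⊥-elim (b≢a (sym a≡b))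
  ... | no  a≢b | yes b≡a = ⊥-elim (a≢b (sym b≡a))

  δ-≢ : ∀ {a b} → a ≢ b → δ a b ≡ 0
  δ-≢ {a} {b} a≢b with a ≟ b
  ... | yes a≡b = ⊥-elim (a≢b a≡b)
  ... | no  _   = refl

  δ-* : ∀ a b (f : A → ℕ) → δ a b * f b ≡ δ a b * f a
  δ-* a b f with a ≟ b
  ... | yes refl = refl
  ... | no  _    = refl

  count : A → List A → ℕ
  count a L = ∑ L (δ a)

  count-∉ : ∀ {a} L → a ∉ L → count a L ≡ 0
  count-∉ [] a∉L = refl
  count-∉ {a} (x ∷ L) a∉L
    rewrite δ-≢ (λ a≡x → a∉L (here a≡x)) = count-∉ L (λ a∈L → a∉L (there a∈L))

  count-∈ : ∀ {a L} → Unique L → a ∈ L → count a L ≡ 1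
  count-∈ {a} {x ∷ L} (x∉L ∷ _) (here refl) with a ≟ a
  ... | yes _ = cong suc (count-∉ L (All¬⇒¬Any x∉L))
  ... | no a≢a = ⊥-elim (a≢a refl)
  count-∈ {a} {x ∷ L} (x∉L ∷ uL) (there a∈L)
    rewrite δ-≢ {a} {x} (λ { refl → All¬⇒¬Any x∉L a∈L }) = count-∈ uL a∈L

  count-view : ∀ a {L} → Unique L → (a ∈ L × count a L ≡ 1) ⊎ (a ∉ L × count a L ≡ 0)
  count-view a {L} uL with a ∈? L
  ... | yes a∈L = inj₁ (a∈L , count-∈ uL a∈L)
  ... | no  a∉L = inj₂ (a∉L , count-∉ L a∉L)

  count≤1 : ∀ a {L} → Unique L → count a L ≤ 1
  count≤1 a uL with count-view a uL
  ... | inj₁ (_ , c≡1) = ≤-reflexive c≡1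
  ... | inj₂ (_ , c≡0) = ≤-trans (≤-reflexive c≡0) z≤n

  ∑-δ : ∀ L x (g : A → ℕ) → ∑ L (λ w → δ x w * g w) ≡ g x * count x L
  ∑-δ L x g = begin
    ∑ L (λ w → δ x w * g w)  ≡⟨ ∑-cong L (λ w → trans (δ-* x w g) (*-comm (δ x w) (g x))) ⟩
    ∑ L (λ w → g x * δ x w)  ≡⟨ ∑-*ˡ L (g x) (δ x) ⟩
    g x * count x L          ∎
    where open ≡-Reasoning

  -- Double counting: if w ↦ f w and z ↦ g z are mutually inverse (in the sense
  -- of δ (f w) z ≡ δ (g z) w) and g maps P into U, then U has exactly |P|
  -- elements w with f w ∈ P.
  ∑-count-preimage : ∀ (f g : A → A) (P U : List A) → (∀ w z → δ (f w) z ≡ δ (g z) w) →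
                     Unique U → (∀ {z} → z ∈ P → g z ∈ U) →
                     ∑ U (λ w → count (f w) P) ≡ ∑ P (λ _ → 1)
  ∑-count-preimage f g P U inverse uU g[P]⊆U = begin
    ∑ U (λ w → ∑ P (δ (f w)))       ≡⟨ ∑-swap U P _ ⟩
    ∑ P (λ z → ∑ U (λ w → δ (f w) z)) ≡⟨ ∑-cong P (λ z → ∑-cong U (λ w → inverse w z)) ⟩
    ∑ P (λ z → count (g z) U)        ≡⟨ ∑-cong∈ P (λ z∈P → count-∈ uU (g[P]⊆U z∈P)) ⟩
    ∑ P (λ _ → 1)                    ∎
    where open ≡-Reasoning

  ∑-≤-support : ∀ (c : A → ℕ) (P L : List A) → Unique P → Unique L →
                (∀ z → c z ≢ 0 → z ∈ L) → ∑ P c ≤ ∑ L c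
  ∑-≤-support c P L uP uL supp = begin
    ∑ P c                                   ≡⟨ ∑-cong P weight ⟩
    ∑ P (λ z → c z * count z L)             ≡⟨ ∑-cong P (λ z → sym (∑-*ˡ L (c z) (δ z))) ⟩
    ∑ P (λ z → ∑ L (λ l → c z * δ z l))     ≡⟨ ∑-swap P L _ ⟩
    ∑ L (λ l → ∑ P (λ z → c z * δ z l))     ≤⟨ ∑-mono L column ⟩
    ∑ L c                                   ∎
    where
    open ≤-Reasoning
    weight : ∀ z → c z ≡ c z * count z L
    weight z with count-view z uL | c z ≟ℕ 0
    ... | inj₁ (_ , n≡1)   | _        = sym (trans (cong (c z *_) n≡1) (*-identityʳ (c z)))
    ... | inj₂ (_ , n≡0)   | yes cz≡0 = trans cz≡0 (sym (trans (cong (c z *_) n≡0) (*-zeroʳ (c z))))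
    ... | inj₂ (z∉L , _)   | no cz≢0  = ⊥-elim (z∉L (supp z cz≢0))
    column : ∀ l → ∑ P (λ z → c z * δ z l) ≤ c l
    column l = begin
      ∑ P (λ z → c z * δ z l) ≡⟨ ∑-cong P (λ z → trans (*-comm (c z) (δ z l)) (cong (_* c z) (δ-sym z l))) ⟩
      ∑ P (λ z → δ l z * c z) ≡⟨ ∑-δ P l c ⟩
      c l * count l P         ≤⟨ *-monoʳ-≤ (c l) (count≤1 l uP) ⟩
      c l * 1                 ≡⟨ *-identityʳ (c l) ⟩
      c l                     ∎

private variable d : ℕ

infix 30 ⊝_
⊝_ : Cell d → Cell d
⊝ v = Vec.map ℤ.-_ v

_⊖_ : Cell d → Cell d → Cell d
z ⊖ v = z ⊕ (⊝ v)

⊖-⊕ : ∀ (z v : Cell d) → (z ⊖ v) ⊕ v ≡ z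
⊖-⊕ z v = begin
  (z ⊕ ⊝ v) ⊕ v  ≡⟨ zipWith-assoc ℤP.+-assoc z (⊝ v) v ⟩
  z ⊕ (⊝ v ⊕ v)  ≡⟨ cong (z ⊕_) (zipWith-inverseˡ ℤP.+-inverseˡ v) ⟩
  z ⊕ 0ᵈ _       ≡⟨ zipWith-identityʳ ℤP.+-identityʳ z ⟩
  z              ∎
  where open ≡-Reasoning

⊕-⊖ : ∀ (w v : Cell d) → (w ⊕ v) ⊖ v ≡ w
⊕-⊖ w v = begin
  (w ⊕ v) ⊕ ⊝ v  ≡⟨ zipWith-assoc ℤP.+-assoc w v (⊝ v) ⟩
  w ⊕ (v ⊕ ⊝ v)  ≡⟨ cong (w ⊕_) (zipWith-inverseʳ ℤP.+-inverseʳ v) ⟩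
  w ⊕ 0ᵈ _       ≡⟨ zipWith-identityʳ ℤP.+-identityʳ w ⟩
  w              ∎
  where open ≡-Reasoning

⊕-cancel : ∀ (x v : Cell d) → x ⊕ v ≡ x → v ≡ 0ᵈ d
⊕-cancel x v x⊕v≡x = begin
  v                ≡⟨ sym (zipWith-identityˡ ℤP.+-identityˡ v) ⟩
  0ᵈ _ ⊕ v         ≡⟨ cong (_⊕ v) (sym (zipWith-inverseˡ ℤP.+-inverseˡ x)) ⟩
  (⊝ x ⊕ x) ⊕ v    ≡⟨ zipWith-assoc ℤP.+-assoc (⊝ x) x v ⟩
  ⊝ x ⊕ (x ⊕ v)    ≡⟨ cong (⊝ x ⊕_) x⊕v≡x ⟩
  ⊝ x ⊕ x          ≡⟨ zipWith-inverseˡ ℤP.+-inverseˡ x ⟩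
  0ᵈ _             ∎
  where open ≡-Reasoning

module Dynamics {d : ℕ} (M : SandpileModel d) where

  open Counting (_≟ᶜ_ {d})

  N : List (Cell d × ℕ)
  N = nbhd M

  δ-shift : ∀ (w v z : Cell d) → δ (w ⊕ v) z ≡ δ (z ⊖ v) w
  δ-shift w v z with (w ⊕ v) ≟ᶜ z | (z ⊖ v) ≟ᶜ w
  ... | yes _     | yes _     = refl
  ... | no  _     | no  _     = refl
  ... | yes w+v≡z | no  z-v≢w = ⊥-elim (z-v≢w (trans (cong (_⊖ v) (sym w+v≡z)) (⊕-⊖ w v)))
  ... | no  w+v≢z | yes z-v≡w = ⊥-elim (w+v≢z (trans (cong (_⊕ v) (sym z-v≡w)) (⊖-⊕ z v)))

  received-∑ : ∀ (L : List (Cell d × ℕ)) x z →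
               received L x z ≡ ∑ L (λ p → proj₂ p * δ (x ⊕ proj₁ p) z)
  received-∑ [] x z = refl
  received-∑ ((v , k) ∷ L) x z with (x ⊕ v) ≟ᶜ z
  ... | yes _ = cong₂ _+_ (sym (*-identityʳ k)) (received-∑ L x z)
  ... | no  _ = trans (received-∑ L x z) (cong (_+ ∑ L (λ p → proj₂ p * δ (x ⊕ proj₁ p) z)) (sym (*-zeroʳ k)))

  received-self : ∀ (L : List (Cell d × ℕ)) → All (λ p → proj₁ p ≢ 0ᵈ d) L → ∀ x → received L x x ≡ 0
  received-self [] _ x = refl
  received-self ((v , k) ∷ L) (v≢0 ∷ L≢0) x with (x ⊕ v) ≟ᶜ x
  ... | yes x+v≡x = ⊥-elim (v≢0 (⊕-cancel x v x+v≡x))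
  ... | no  _     = received-self L L≢0 x

  fires : Config d → Cell d → ℕ
  fires c x with θ M ≤? c x
  ... | yes _ = 1
  ... | no  _ = 0

  topple-idle : ∀ {c x} → ¬ θ M ≤ c x → ∀ z → topple M x c z ≡ c z
  topple-idle {c} {x} stable z with θ M ≤? c x
  ... | yes unstable = ⊥-elim (stable unstable)
  ... | no  _        = refl

  topple-fire : ∀ {c x} → θ M ≤ c x → ∀ z → topple M x c z + θ M * δ z x ≡ c z + received N x z
  topple-fire {c} {x} unstable z with θ M ≤? c x
  ... | no stable = ⊥-elim (stable unstable)
  ... | yes _ with z ≟ᶜ x
  ...   | yes refl rewrite received-self N (nonzero M) x | *-identityʳ (θ M) =
            trans (m∸n+n≡m unstable) (sym (+-identityʳ (c x)))
  ...   | no  _    = trans (cong (c z + received N x z +_) (*-zeroʳ (θ M))) (+-identityʳ (c z + received N x z))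

  odo-cons : ∀ c x xs w → odo M c (x ∷ xs) w ≡ fires c x * δ x w + odo M (topple M x c) xs w
  odo-cons c x xs w with θ M ≤? c x in unstable? | x ≟ᶜ w
  ... | yes _ | yes _ rewrite unstable? = refl
  ... | yes _ | no  _ rewrite unstable? = refl
  ... | no  _ | yes _ rewrite unstable? = refl
  ... | no  _ | no  _ rewrite unstable? = refl

  odo-outside : ∀ c xs w → w ∉ xs → odo M c xs w ≡ 0
  odo-outside c [] w _ = refl
  odo-outside c (x ∷ xs) w w∉x∷xs = begin
    odo M c (x ∷ xs) w                              ≡⟨ odo-cons c x xs w ⟩
    fires c x * δ x w + odo M (topple M x c) xs w   ≡⟨ cong₂ (λ a b → fires c x * a + b) (δ-≢ (λ x≡w → w∉x∷xs (here (sym x≡w))))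
                                                                 (odo-outside (topple M x c) xs w (λ w∈xs → w∉x∷xs (there w∈xs))) ⟩
    fires c x * 0 + 0                               ≡⟨ cong (_+ 0) (*-zeroʳ (fires c x)) ⟩
    0                                               ∎
    where open ≡-Reasoning

  ∑-odo-cons : ∀ {U} → Unique U → ∀ {x} → x ∈ U → ∀ c xs (g : Cell d → ℕ) →
               ∑ U (λ w → odo M c (x ∷ xs) w * g w)
                 ≡ fires c x * g x + ∑ U (λ w → odo M (topple M x c) xs w * g w)
  ∑-odo-cons {U} uU {x} x∈U c xs g = begin
    ∑ U (λ w → odo M c (x ∷ xs) w * g w)
      ≡⟨ ∑-cong U (λ w → trans (cong (_* g w) (odo-cons c x xs w)) (distrib w)) ⟩
    ∑ U (λ w → fires c x * (δ x w * g w) + u' w * g w)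
      ≡⟨ ∑-+ U _ _ ⟩
    ∑ U (λ w → fires c x * (δ x w * g w)) + ∑ U (λ w → u' w * g w)
      ≡⟨ cong (_+ ∑ U (λ w → u' w * g w)) (trans (∑-*ˡ U (fires c x) _) (cong (fires c x *_) sift)) ⟩
    fires c x * g x + ∑ U (λ w → u' w * g w)
      ∎
    where
    open ≡-Reasoning
    u' : Cell d → ℕ
    u' = odo M (topple M x c) xs
    distrib : ∀ w → (fires c x * δ x w + u' w) * g w ≡ fires c x * (δ x w * g w) + u' w * g w
    distrib w = trans (*-distribʳ-+ (g w) (fires c x * δ x w) (u' w)) (cong (_+ u' w * g w) (*-assoc (fires c x) (δ x w) (g w)))
    sift : ∑ U (λ w → δ x w * g w) ≡ g x
    sift = trans (∑-δ U x g) (trans (cong (g x *_) (count-∈ uU x∈U)) (*-identityʳ (g x)))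

  fires-view : ∀ c x → (θ M ≤ c x × fires c x ≡ 1) ⊎ (¬ θ M ≤ c x × fires c x ≡ 0)
  fires-view c x with θ M ≤? c x
  ... | yes unstable = inj₁ (unstable , refl)
  ... | no  stable   = inj₂ (stable , refl)

  -- Grain flow across the boundary of a finite set P of cells
  module Flux (P : List (Cell d)) (uP : Unique P) where

    χ χ̄ : Cell d → ℕ
    χ w = count w P
    χ̄ w = 1 ∸ χ w

    χ+χ̄ : ∀ w → χ w + χ̄ w ≡ 1
    χ+χ̄ w with count-view w uP
    ... | inj₁ (_ , χ≡1) rewrite χ≡1 = refl
    ... | inj₂ (_ , χ≡0) rewrite χ≡0 = refl

    inflow outflow : Cell d → ℕ
    inflow  w = ∑ N (λ p → proj₂ p * χ  (w ⊕ proj₁ p))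
    outflow w = ∑ N (λ p → proj₂ p * χ̄ (w ⊕ proj₁ p))

    -- grains crossing the boundary of P, outwards resp. inwards, when w topples
    leaving entering : Cell d → ℕ
    leaving  w = χ  w * outflow w
    entering w = χ̄ w * inflow w

    mass : Config d → ℕ
    mass c = ∑ P c

    leaving-∈ : ∀ {w} → w ∈ P → leaving w ≡ outflow w
    leaving-∈ {w} w∈P = trans (cong (_* outflow w) (count-∈ uP w∈P)) (*-identityˡ (outflow w))

    leaving-∉ : ∀ {w} → w ∉ P → leaving w ≡ 0
    leaving-∉ {w} w∉P = cong (_* outflow w) (count-∉ P w∉P)

    entering-∈ : ∀ {w} → w ∈ P → entering w ≡ 0
    entering-∈ {w} w∈P = cong (λ n → (1 ∸ n) * inflow w) (count-∈ uP w∈P)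

    entering-∉ : ∀ {w} → w ∉ P → entering w ≡ inflow w
    entering-∉ {w} w∉P = trans (cong (λ n → (1 ∸ n) * inflow w) (count-∉ P w∉P)) (*-identityˡ (inflow w))

    leaving-support : ∀ {w} → leaving w ≢ 0 → w ∈ P
    leaving-support {w} leaving≢0 with count-view w uP
    ... | inj₁ (w∈P , _) = w∈P
    ... | inj₂ (w∉P , _) = ⊥-elim (leaving≢0 (leaving-∉ w∉P))

    entering-support : ∀ {w} → entering w ≢ 0 → w ∉ P
    entering-support entering≢0 w∈P = entering≢0 (entering-∈ w∈P)

    θ-split : ∀ w → θ M ≡ inflow w + outflow w
    θ-split w = begin
      ∑ N proj₂
        ≡⟨ ∑-cong N (λ p → sym (share p)) ⟩
      ∑ N (λ p → proj₂ p * χ (w ⊕ proj₁ p) + proj₂ p * χ̄ (w ⊕ proj₁ p))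
        ≡⟨ ∑-+ N _ _ ⟩
      inflow w + outflow w
        ∎
      where
      open ≡-Reasoning
      share : ∀ p → proj₂ p * χ (w ⊕ proj₁ p) + proj₂ p * χ̄ (w ⊕ proj₁ p) ≡ proj₂ p
      share p = trans (sym (*-distribˡ-+ (proj₂ p) _ _))
                      (trans (cong (proj₂ p *_) (χ+χ̄ (w ⊕ proj₁ p))) (*-identityʳ (proj₂ p)))

    received-mass : ∀ w → ∑ P (received N w) ≡ inflow w
    received-mass w = begin
      ∑ P (received N w)                                   ≡⟨ ∑-cong P (received-∑ N w) ⟩
      ∑ P (λ z → ∑ N (λ p → proj₂ p * δ (w ⊕ proj₁ p) z))   ≡⟨ ∑-swap P N _ ⟩
      ∑ N (λ p → ∑ P (λ z → proj₂ p * δ (w ⊕ proj₁ p) z))   ≡⟨ ∑-cong N (λ p → ∑-*ˡ P (proj₂ p) (δ (w ⊕ proj₁ p))) ⟩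
      inflow w                                             ∎
      where open ≡-Reasoning

    topple-mass : ∀ {c w} → θ M ≤ c w → mass (topple M w c) + θ M * χ w ≡ mass c + inflow w
    topple-mass {c} {w} unstable = begin
      mass c' + θ M * χ w
        ≡⟨ cong (λ n → mass c' + θ M * n) (∑-cong P (δ-sym w)) ⟩
      mass c' + θ M * ∑ P (λ z → δ z w)
        ≡⟨ cong (mass c' +_) (sym (∑-*ˡ P (θ M) (λ z → δ z w))) ⟩
      mass c' + ∑ P (λ z → θ M * δ z w)
        ≡⟨ sym (∑-+ P c' _) ⟩
      ∑ P (λ z → c' z + θ M * δ z w)
        ≡⟨ ∑-cong P (topple-fire unstable) ⟩
      ∑ P (λ z → c z + received N w z)
        ≡⟨ ∑-+ P c (received N w) ⟩
      mass c + ∑ P (received N w)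
        ≡⟨ cong (mass c +_) (received-mass w) ⟩
      mass c + inflow w
        ∎
      where
      open ≡-Reasoning
      c' : Config d
      c' = topple M w c

    firing-balance : ∀ {c w} → θ M ≤ c w → mass (topple M w c) + leaving w ≡ mass c + entering w
    firing-balance {c} {w} unstable with count-view w uP
    ... | inj₁ (w∈P , χ≡1) = +-cancelʳ-≡ (inflow w) _ _ (begin
      mass c' + leaving w + inflow w   ≡⟨ cong (λ n → mass c' + n + inflow w) (leaving-∈ w∈P) ⟩
      mass c' + outflow w + inflow w   ≡⟨ xy∙z≈x∙zy (mass c') (outflow w) (inflow w) ⟩
      mass c' + (inflow w + outflow w) ≡⟨ cong (mass c' +_) (sym (θ-split w)) ⟩
      mass c' + θ M                    ≡⟨ cong (mass c' +_) (sym (trans (cong (θ M *_) χ≡1) (*-identityʳ (θ M)))) ⟩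
      mass c' + θ M * χ w              ≡⟨ topple-mass unstable ⟩
      mass c + inflow w                ≡⟨ cong (_+ inflow w) (sym (+-identityʳ (mass c))) ⟩
      mass c + 0 + inflow w            ≡⟨ cong (λ n → mass c + n + inflow w) (sym (entering-∈ w∈P)) ⟩
      mass c + entering w + inflow w   ∎)
      where
      open ≡-Reasoning
      c' : Config d
      c' = topple M w c
    ... | inj₂ (w∉P , χ≡0) = begin
      mass c' + leaving w              ≡⟨ cong (mass c' +_) (trans (leaving-∉ w∉P) (sym (trans (cong (θ M *_) χ≡0) (*-zeroʳ (θ M))))) ⟩
      mass c' + θ M * χ w              ≡⟨ topple-mass unstable ⟩
      mass c + inflow w                ≡⟨ cong (mass c +_) (sym (entering-∉ w∉P)) ⟩
      mass c + entering w              ∎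
      where
      open ≡-Reasoning
      c' : Config d
      c' = topple M w c

    update-balance : ∀ c w → mass (topple M w c) + fires c w * leaving w ≡ mass c + fires c w * entering w
    update-balance c w with fires-view c w
    ... | inj₁ (unstable , fires≡1) rewrite fires≡1 =
      trans (cong (mass (topple M w c) +_) (*-identityˡ (leaving w)))
            (trans (firing-balance unstable) (cong (mass c +_) (sym (*-identityˡ (entering w)))))
    ... | inj₂ (stable , fires≡0) rewrite fires≡0 = cong (_+ 0) (∑-cong P (topple-idle stable))

    run-balance : ∀ {U} → Unique U → ∀ c xs → (∀ {x} → x ∈ xs → x ∈ U) →
                  mass (run M c xs) + ∑ U (λ w → odo M c xs w * leaving w)
                    ≡ mass c + ∑ U (λ w → odo M c xs w * entering w)
    run-balance uU c [] xs⊆U = refl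
    run-balance {U} uU c (x ∷ xs) x∷xs⊆U = begin
      mass (run M c' xs) + ∑ U (λ w → odo M c (x ∷ xs) w * leaving w)
        ≡⟨ cong (mass (run M c' xs) +_) (∑-odo-cons uU x∈U c xs leaving) ⟩
      mass (run M c' xs) + (F * leaving x + out')
        ≡⟨ x∙yz≈xz∙y (mass (run M c' xs)) (F * leaving x) out' ⟩
      mass (run M c' xs) + out' + F * leaving x
        ≡⟨ cong (_+ F * leaving x) (run-balance uU c' xs (λ w∈xs → x∷xs⊆U (there w∈xs))) ⟩
      mass c' + in' + F * leaving x
        ≡⟨ xy∙z≈xz∙y (mass c') in' (F * leaving x) ⟩
      mass c' + F * leaving x + in'
        ≡⟨ cong (_+ in') (update-balance c x) ⟩
      mass c + F * entering x + in'
        ≡⟨ +-assoc (mass c) (F * entering x) in' ⟩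
      mass c + (F * entering x + in')
        ≡⟨ cong (mass c +_) (sym (∑-odo-cons uU x∈U c xs entering)) ⟩
      mass c + ∑ U (λ w → odo M c (x ∷ xs) w * entering w)
        ∎
      where
      open ≡-Reasoning
      x∈U : x ∈ U
      x∈U = x∷xs⊆U (here refl)
      c' : Config d
      c' = topple M x c
      F out' in' : ℕ
      F    = fires c x
      out' = ∑ U (λ w → odo M c' xs w * leaving w)
      in'  = ∑ U (λ w → odo M c' xs w * entering w)

    -- Translation invariance: for each direction v, the pairs (w, w + v) leaving P
    -- are as many as those entering P, provided U contains P and P - v.
    crossing-balance : ∀ {U} → Unique U → (∀ {z} → z ∈ P → z ∈ U) → ∀ v → (∀ {z} → z ∈ P → z ⊖ v ∈ U) →
                       ∑ U (λ w → χ w * χ̄ (w ⊕ v)) ≡ ∑ U (λ w → χ̄ w * χ (w ⊕ v))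
    crossing-balance {U} uU P⊆U v P-v⊆U = +-cancelˡ-≡ both _ _ (begin
      both + ∑ U (λ w → χ w * χ̄ (w ⊕ v))  ≡⟨ sym (∑-+ U _ _) ⟩
      ∑ U (λ w → χ w * χ (w ⊕ v) + χ w * χ̄ (w ⊕ v))
                                          ≡⟨ ∑-cong U (λ w → split-by (χ w) (w ⊕ v)) ⟩
      ∑ U χ                               ≡⟨ ∑-count-preimage (λ w → w) (λ z → z) P U δ-sym uU P⊆U ⟩
      ∑ P (λ _ → 1)                       ≡⟨ sym (∑-count-preimage (_⊕ v) (_⊖ v) P U (λ w z → δ-shift w v z) uU P-v⊆U) ⟩
      ∑ U (λ w → χ (w ⊕ v))               ≡⟨ sym (∑-cong U split-by′) ⟩
      ∑ U (λ w → χ w * χ (w ⊕ v) + χ̄ w * χ (w ⊕ v))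
                                          ≡⟨ ∑-+ U _ _ ⟩
      both + ∑ U (λ w → χ̄ w * χ (w ⊕ v))  ∎)
      where
      open ≡-Reasoning
      both : ℕ
      both = ∑ U (λ w → χ w * χ (w ⊕ v))
      split-by : ∀ n z → n * χ z + n * χ̄ z ≡ n
      split-by n z = trans (sym (*-distribˡ-+ n (χ z) (χ̄ z))) (trans (cong (n *_) (χ+χ̄ z)) (*-identityʳ n))
      split-by′ : ∀ w → χ w * χ (w ⊕ v) + χ̄ w * χ (w ⊕ v) ≡ χ (w ⊕ v)
      split-by′ w = trans (sym (*-distribʳ-+ (χ (w ⊕ v)) (χ w) (χ̄ w))) (trans (cong (_* χ (w ⊕ v)) (χ+χ̄ w)) (*-identityˡ (χ (w ⊕ v))))

    flux-balance : ∀ {U} → Unique U → (∀ {z} → z ∈ P → z ∈ U) →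
                   (∀ {z p} → z ∈ P → p ∈ N → z ⊖ proj₁ p ∈ U) →
                   ∑ U leaving ≡ ∑ U entering
    flux-balance {U} uU P⊆U P-N⊆U = begin
      ∑ U leaving                                              ≡⟨ regroup χ χ̄ ⟩
      ∑ N (λ p → proj₂ p * ∑ U (λ w → χ w * χ̄ (w ⊕ proj₁ p))) ≡⟨ ∑-cong∈ N (λ {p} p∈N → cong (proj₂ p *_) (crossing p∈N)) ⟩
      ∑ N (λ p → proj₂ p * ∑ U (λ w → χ̄ w * χ (w ⊕ proj₁ p))) ≡⟨ sym (regroup χ̄ χ) ⟩
      ∑ U entering                                             ∎
      where
      open ≡-Reasoning
      crossing : ∀ {p} → p ∈ N → ∑ U (λ w → χ w * χ̄ (w ⊕ proj₁ p)) ≡ ∑ U (λ w → χ̄ w * χ (w ⊕ proj₁ p))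
      crossing p∈N = crossing-balance uU P⊆U _ (λ z∈P → P-N⊆U z∈P p∈N)
      regroup : ∀ (f g : Cell d → ℕ) →
                ∑ U (λ w → f w * ∑ N (λ p → proj₂ p * g (w ⊕ proj₁ p)))
                  ≡ ∑ N (λ p → proj₂ p * ∑ U (λ w → f w * g (w ⊕ proj₁ p)))
      regroup f g = begin
        ∑ U (λ w → f w * ∑ N (λ p → proj₂ p * g (w ⊕ proj₁ p)))   ≡⟨ ∑-cong U (λ w → sym (∑-*ˡ N (f w) _)) ⟩
        ∑ U (λ w → ∑ N (λ p → f w * (proj₂ p * g (w ⊕ proj₁ p)))) ≡⟨ ∑-cong U (λ w → ∑-cong N (λ p → *-left-comm (f w) (proj₂ p) _)) ⟩
        ∑ U (λ w → ∑ N (λ p → proj₂ p * (f w * g (w ⊕ proj₁ p)))) ≡⟨ ∑-swap U N _ ⟩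
        ∑ N (λ p → ∑ U (λ w → proj₂ p * (f w * g (w ⊕ proj₁ p)))) ≡⟨ ∑-cong N (λ p → ∑-*ˡ U (proj₂ p) _) ⟩
        ∑ N (λ p → proj₂ p * ∑ U (λ w → f w * g (w ⊕ proj₁ p)))   ∎

    inflow-pos : ∀ {w p} → p ∈ N → w ⊕ proj₁ p ∈ P → 1 ≤ inflow w
    inflow-pos {w} {p} p∈N w+v∈P = begin
      1                         ≤⟨ All.lookup (positive M) p∈N ⟩
      proj₂ p                   ≡⟨ trans (cong (proj₂ p *_) (count-∈ uP w+v∈P)) (*-identityʳ (proj₂ p)) ⟨
      proj₂ p * χ (w ⊕ proj₁ p) ≤⟨ ∑-term N {f = λ q → proj₂ q * χ (w ⊕ proj₁ q)} p∈N ⟩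
      inflow w                  ∎
      where open ≤-Reasoning

    outflow-pos : ∀ {w p} → p ∈ N → w ⊕ proj₁ p ∉ P → 1 ≤ outflow w
    outflow-pos {w} {p} p∈N w+v∉P = begin
      1                          ≤⟨ All.lookup (positive M) p∈N ⟩
      proj₂ p                    ≡⟨ trans (cong (λ n → proj₂ p * (1 ∸ n)) (count-∉ P w+v∉P)) (*-identityʳ (proj₂ p)) ⟨
      proj₂ p * χ̄ (w ⊕ proj₁ p) ≤⟨ ∑-term N {f = λ q → proj₂ q * χ̄ (w ⊕ proj₁ q)} p∈N ⟩
      outflow w                  ∎
      where open ≤-Reasoning

    level-cut : ∀ c xs m {U} → Unique U → (∀ {x} → x ∈ xs → x ∈ U) → (∀ {z} → z ∈ P → z ∈ U) →
                (∀ {z p} → z ∈ P → p ∈ N → z ⊖ proj₁ p ∈ U) →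
                (∀ {w} → w ∈ P → m ≤ odo M c xs w) → (∀ {w} → w ∉ P → odo M c xs w ≤ m) →
                ∑ U (λ w → (odo M c xs w ∸ m) * leaving w) + ∑ U (λ w → (m ∸ odo M c xs w) * entering w)
                  ≤ mass c
    level-cut c xs m {U} uU xs⊆U P⊆U P-N⊆U above below = +-cancelʳ-≤ b (excess + deficit) (mass c) (begin
      excess + deficit + b          ≡⟨ +-assoc excess deficit b ⟩
      excess + (deficit + b)        ≡⟨ cong (excess +_) deficit+b ⟩
      excess + m * ∑ U entering     ≡⟨ cong (λ n → excess + m * n) (sym (flux-balance uU P⊆U P-N⊆U)) ⟩
      excess + m * ∑ U leaving      ≡⟨ excess+ ⟩
      a                             ≤⟨ m≤n+m a (mass (run M c xs)) ⟩
      mass (run M c xs) + a         ≡⟨ run-balance uU c xs xs⊆U ⟩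
      mass c + b                    ∎)
      where
      open ≤-Reasoning
      u : Cell d → ℕ
      u = odo M c xs
      a b excess deficit : ℕ
      a       = ∑ U (λ w → u w * leaving w)
      b       = ∑ U (λ w → u w * entering w)
      excess  = ∑ U (λ w → (u w ∸ m) * leaving w)
      deficit = ∑ U (λ w → (m ∸ u w) * entering w)
      excess+ : excess + m * ∑ U leaving ≡ a
      excess+ = trans (cong (excess +_) (sym (∑-*ˡ U m leaving)))
                (trans (sym (∑-+ U _ _))
                       (∑-cong U (λ w → split-at-level (u w) m (leaving w) (λ ≢0 → above (leaving-support ≢0)))))
      deficit+b : deficit + b ≡ m * ∑ U entering
      deficit+b = trans (sym (∑-+ U _ _))
                  (trans (∑-cong U (λ w → split-at-level m (u w) (entering w) (λ ≢0 → below (entering-support ≢0))))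
                         (∑-*ˡ U m entering))

  -- A run xs from c: its odometer u, the cells U it can involve (updated cells
  -- and their in-neighbours), and the superlevel sets of u.
  module Run (c : Config d) (xs : List (Cell d)) where

    open import Data.List.Membership.DecPropositional (_≟ᶜ_ {d}) using (_∈?_)
    open import Data.List.Relation.Unary.Unique.DecPropositional.Properties (_≟ᶜ_ {d}) using (deduplicate-!; filter⁺)

    u : Cell d → ℕ
    u = odo M c xs

    U : List (Cell d)
    U = deduplicate _≟ᶜ_ (xs ++ concatMap (λ z → map (λ p → z ⊖ proj₁ p) N) xs)

    U-unique : Unique U
    U-unique = deduplicate-! _

    xs⊆U : ∀ {z} → z ∈ xs → z ∈ U
    xs⊆U z∈xs = ∈-deduplicate⁺ _≟ᶜ_ (∈-++⁺ˡ z∈xs)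

    xs-N⊆U : ∀ {z p} → z ∈ xs → p ∈ N → z ⊖ proj₁ p ∈ U
    xs-N⊆U {z} z∈xs p∈N =
      ∈-deduplicate⁺ _≟ᶜ_ (∈-++⁺ʳ xs (∈-concatMap⁺ (λ z → map (λ p → z ⊖ proj₁ p) N) (Any.map (λ { refl → ∈-map⁺ (λ p → z ⊖ proj₁ p) p∈N }) z∈xs)))

    superlevel : ℕ → List (Cell d)
    superlevel k = filter (λ z → k ≤? u z) (deduplicate _≟ᶜ_ xs)

    superlevel-unique : ∀ k → Unique (superlevel k)
    superlevel-unique k = filter⁺ (λ z → k ≤? u z) (deduplicate-! xs)

    superlevel⊆xs : ∀ {k z} → z ∈ superlevel k → z ∈ xs
    superlevel⊆xs {k} z∈P = ∈-deduplicate⁻ _≟ᶜ_ xs (proj₁ (∈-filter⁻ (λ z → k ≤? u z) {xs = deduplicate _≟ᶜ_ xs} z∈P))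

    ∈-superlevel⁻ : ∀ {k z} → z ∈ superlevel k → k ≤ u z
    ∈-superlevel⁻ {k} z∈P = proj₂ (∈-filter⁻ (λ z → k ≤? u z) {xs = deduplicate _≟ᶜ_ xs} z∈P)

    ∈-superlevel⁺ : ∀ {k z} → 1 ≤ k → k ≤ u z → z ∈ superlevel k
    ∈-superlevel⁺ {k} {z} 1≤k k≤uz with z ∈? xs
    ... | yes z∈xs = ∈-filter⁺ (λ z → k ≤? u z) (∈-deduplicate⁺ _≟ᶜ_ z∈xs) k≤uz
    ... | no  z∉xs = ⊥-elim (<⇒≱ (≤-trans 1≤k k≤uz) (≤-reflexive (odo-outside c xs z z∉xs)))

    ∉-superlevel : ∀ {k z} → 1 ≤ k → z ∉ superlevel k → u z < k
    ∉-superlevel {k} {z} 1≤k z∉P with k ≤? u z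
    ... | yes k≤uz = ⊥-elim (z∉P (∈-superlevel⁺ 1≤k k≤uz))
    ... | no  k≰uz = ≰⇒> k≰uz

    superlevel-cut : ∀ k m → 1 ≤ k → m ≤ k → k ≤ suc m →
                     let open Flux (superlevel k) (superlevel-unique k) in
                     ∑ U (λ w → (u w ∸ m) * leaving w) + ∑ U (λ w → (m ∸ u w) * entering w) ≤ mass c
    superlevel-cut k m 1≤k m≤k k≤1+m =
      level-cut c xs m U-unique xs⊆U (λ z∈P → xs⊆U (superlevel⊆xs z∈P))
        (λ z∈P p∈N → xs-N⊆U (superlevel⊆xs z∈P) p∈N)
        (λ w∈P → ≤-trans m≤k (∈-superlevel⁻ w∈P))
        (λ w∉P → m<1+n⇒m≤n (<-≤-trans (∉-superlevel 1≤k w∉P) k≤1+m))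
      where open Flux (superlevel k) (superlevel-unique k)

    drop-bound : ∀ {x y p} → p ∈ N → y ≡ x ⊕ proj₁ p → u y < u x →
                 u x ∸ u y ≤ ∑ (superlevel (suc (u y))) c
    drop-bound {x} {y} {p} p∈N y≡x+v uy<ux = begin
      u x ∸ u y                ≤⟨ m≤m*n (u x ∸ u y) (leaving x) {{>-nonZero leaving-x-pos}} ⟩
      (u x ∸ u y) * leaving x  ≤⟨ ∑-term U {f = λ w → (u w ∸ u y) * leaving w} (xs⊆U (superlevel⊆xs x∈P)) ⟩
      excess                   ≤⟨ m≤m+n excess _ ⟩
      excess + _               ≤⟨ superlevel-cut (suc (u y)) (u y) (s≤s z≤n) (n≤1+n (u y)) ≤-refl ⟩
      mass c                   ∎
      where
      open ≤-Reasoning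
      P : List (Cell d)
      P = superlevel (suc (u y))
      open Flux P (superlevel-unique (suc (u y)))
      excess : ℕ
      excess = ∑ U (λ w → (u w ∸ u y) * leaving w)
      x∈P : x ∈ P
      x∈P = ∈-superlevel⁺ (s≤s z≤n) uy<ux
      y∉P : y ∉ P
      y∉P y∈P = <-irrefl refl (∈-superlevel⁻ y∈P)
      leaving-x-pos : 1 ≤ leaving x
      leaving-x-pos = subst (1 ≤_) (sym (leaving-∈ x∈P)) (outflow-pos p∈N (subst (_∉ P) y≡x+v y∉P))

    rise-bound : ∀ {x y p} → p ∈ N → y ≡ x ⊕ proj₁ p → u x < u y →
                 u y ∸ u x ≤ ∑ (superlevel (u y)) c
    rise-bound {x} {y} {p} p∈N y≡x+v ux<uy = begin
      u y ∸ u x                 ≤⟨ m≤m*n (u y ∸ u x) (entering x) {{>-nonZero entering-x-pos}} ⟩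
      (u y ∸ u x) * entering x  ≤⟨ ∑-term U {f = λ w → (u y ∸ u w) * entering w} x∈U ⟩
      deficit                   ≤⟨ m≤n+m deficit _ ⟩
      _ + deficit               ≤⟨ superlevel-cut (u y) (u y) 1≤uy ≤-refl (n≤1+n (u y)) ⟩
      mass c                    ∎
      where
      open ≤-Reasoning
      P : List (Cell d)
      P = superlevel (u y)
      open Flux P (superlevel-unique (u y))
      deficit : ℕ
      deficit = ∑ U (λ w → (u y ∸ u w) * entering w)
      1≤uy : 1 ≤ u y
      1≤uy = <-≤-trans (s≤s z≤n) ux<uy
      y∈P : y ∈ P
      y∈P = ∈-superlevel⁺ 1≤uy ≤-refl
      x∉P : x ∉ P
      x∉P x∈P = <⇒≱ ux<uy (∈-superlevel⁻ x∈P)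
      x∈U : x ∈ U
      x∈U = subst (_∈ U) (trans (cong (_⊖ proj₁ p) y≡x+v) (⊕-⊖ x (proj₁ p))) (xs-N⊆U (superlevel⊆xs y∈P) p∈N)
      entering-x-pos : 1 ≤ entering x
      entering-x-pos = subst (1 ≤_) (sym (entering-∉ x∉P)) (inflow-pos p∈N (subst (_∈ P) y≡x+v y∈P))

-- The bound holds for every update sequence xs.
lemma2 : ∀ {d : ℕ} (M : SandpileModel d) (c c' : Config d) (L : List (Cell d))
           → SupportList c L → Finite c'
           → (xs : List (Cell d)) → M ⊢ c ⇀* c' via xs
           → (x y : Cell d) → (∃ λ v → v ∈ 𝒩 M × y ≡ x ⊕ v)
           → ∣ odo M c xs x - odo M c xs y ∣ ≤ totalGrains c L
lemma2 {d} M c c' L (uL , supp) _ xs _ x y (v , v∈𝒩 , y≡x+v) with ∈-map⁻ proj₁ v∈𝒩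
... | p , p∈N , v≡p = by-cases (<-cmp (u x) (u y))
  where
  open Counting (_≟ᶜ_ {d}) using (∑-≤-support)
  open Dynamics M
  open Run c xs
  y≡x+p : y ≡ x ⊕ proj₁ p
  y≡x+p = trans y≡x+v (cong (x ⊕_) v≡p)
  grains : ∀ k → ∑ (superlevel k) c ≤ totalGrains c L
  grains k = ∑-≤-support c (superlevel k) L (superlevel-unique k) uL supp
  by-cases : Tri (u x < u y) (u x ≡ u y) (u y < u x) → ∣ u x - u y ∣ ≤ totalGrains c L
  by-cases (tri< ux<uy _ _) = subst (_≤ totalGrains c L) (sym (m≤n⇒∣m-n∣≡n∸m (<⇒≤ ux<uy)))
                                (≤-trans (rise-bound p∈N y≡x+p ux<uy) (grains (u y)))
  by-cases (tri≈ _ ux≡uy _) = subst (_≤ totalGrains c L) (sym (m≡n⇒∣m-n∣≡0 ux≡uy)) z≤n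
  by-cases (tri> _ _ uy<ux) = subst (_≤ totalGrains c L) (sym (m≤n⇒∣n-m∣≡n∸m (<⇒≤ uy<ux)))
                                (≤-trans (drop-bound p∈N y≡x+p uy<ux) (grains (suc (u y))))
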